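{- Let $n\ge1$ and $0\le r\le n-1$. Then the Schur reflect of the hook $(n-r,1^r)$ (whose leg has length $r+1$) is a weighted isobaric polynomial: $\hat{S}_{(n-r,1^r)}=P_{n,\omega^{(r)}}$, where $\omega^{(r)}=(-1)^r(0,\ldots,0,1,1,\ldots)$, i.e. $\omega^{(r)}_j=0$ for $j\le r$ and $\omega^{(r)}_j=(-1)^r$ for $j>r$.
   Context: Let $\Lambda$ be the ring of symmetric functions over $\mathbb{Z}$ (infinitely many variables) with elementary symmetric functions $e_j$ and Schur functions $S_\lambda$; let $\Xi:\Lambda\to\mathbb{Z}[t_1,t_2,\ldots]$ be the ring isomorphism with $\Xi(e_j)=(-1)^{j+1}t_j$, and $\hat{S}_\lambda=\Xi(S_\lambda)$. For a finitely supported vector $\alpha$ of nonnegative integers write $t^\alpha=\prod_i t_i^{\alpha_i}$, $|\alpha|=\sum_i\alpha_i$, and $\alpha\vdash n$ if $\sum_i i\alpha_i=n$. For a weight vector $\omega=(\omega_1,\omega_2,\ldots)$ define $A_\omega(e_i)=\omega_i$ ($e_i$ the $i$-th unit vector) and, for $|\alpha|\ge2$, $A_\omega(\alpha)=\sum_{i:\alpha_i\ge1}A_\omega(\alpha-e_i)$; the weighted isobaric polynomial of level $n$ and weight $\omega$ is $P_{n,\omega}=\sum_{\alpha\vdash n}A_\omega(\alpha)t^\alpha$. -}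

module Defs where

open import Level using (Level)
open import Data.Nat as ℕ using (ℕ; zero; suc; _≤?_; _⊔_)
open import Data.Integer as ℤ using (ℤ; +_; -[1+_])
open import Data.Fin using (Fin; zero; suc; toℕ; punchIn)
open import Data.Vec using (Vec; []; _∷_)
open import Data.List as List using (List; []; _∷_; upTo; length; lookup; filter; concatMap; replicate)
open import Algebra.Bundles using (CommutativeRing)
import Relation.Nullary

-- Integer vectors: α : Vec ℕ m, component at position k : Fin m is α_{toℕ k + 1}.

size : ∀ {m} → Vec ℕ m → ℕ
size [] = 0
size (a ∷ α) = a ℕ.+ size α

weightFrom : ∀ {m} → ℕ → Vec ℕ m → ℕ
weightFrom i [] = 0
weightFrom i (a ∷ α) = i ℕ.* a ℕ.+ weightFrom (suc i) α

weight : ∀ {m} → Vec ℕ m → ℕ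
weight = weightFrom 1

allVecs : ℕ → (m : ℕ) → List (Vec ℕ m)
allVecs b zero = [] ∷ []
allVecs b (suc m) = concatMap (λ x → List.map (x ∷_) (allVecs b m)) (upTo (suc b))

-- all α with α ⊢ n (α supported in positions 1..n, as α_i = 0 for i > n necessarily)
partitionsVec : (n : ℕ) → List (Vec ℕ n)
partitionsVec n = filter (λ α → weight α ℕ.≟ n) (allVecs n n)

-- α - e_k  (only used when α_k ≥ 1)
decAt : ∀ {m} → Fin m → Vec ℕ m → Vec ℕ m
decAt zero (a ∷ α) = (a ℕ.∸ 1) ∷ α
decAt (suc k) (a ∷ α) = a ∷ decAt k α

lookupV : ∀ {m} → Vec ℕ m → Fin m → ℕ
lookupV (a ∷ α) zero = a
lookupV (a ∷ α) (suc k) = lookupV α k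

-- conjugate partition of λ (given as a weakly decreasing list of positive parts)
conjugate : List ℕ → List ℕ
conjugate λp = List.map (λ i → length (filter (λ x → suc i ≤? x) λp)) (upTo (List.foldr _⊔_ 0 λp))

hook : ℕ → ℕ → List ℕ
hook n r = (n ℕ.∸ r) ∷ replicate r 1

module Over {c ℓ : Level} (R : CommutativeRing c ℓ) where
  open CommutativeRing R hiding (zero)

  pow : Carrier → ℕ → Carrier
  pow x zero = 1#
  pow x (suc k) = x * pow x k

  sumList : List Carrier → Carrier
  sumList = List.foldr _+_ 0#

  sumFin : ∀ m → (Fin m → Carrier) → Carrier
  sumFin zero f = 0#
  sumFin (suc m) f = f zero + sumFin m (λ k → f (suc k))

  det : ∀ m → (Fin m → Fin m → Carrier) → Carrier
  det zero M = 1#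
  det (suc m) M =
    sumFin (suc m) (λ j → pow (- 1#) (toℕ j) * M zero j * det m (λ i k → M (suc i) (punchIn j k)))

  -- a polynomial ring element is represented by its value at an arbitrary point
  -- t : ℕ → Carrier of an arbitrary commutative ring (t k stands for t_k, k ≥ 1; t 0 unused)

  monoFrom : ∀ {m} → (ℕ → Carrier) → ℕ → Vec ℕ m → Carrier
  monoFrom t i [] = 1#
  monoFrom t i (a ∷ α) = pow (t i) a * monoFrom t (suc i) α

  mono : ∀ {m} → (ℕ → Carrier) → Vec ℕ m → Carrier
  mono t = monoFrom t 1

  sumSupp : ∀ {m} → Vec ℕ m → (Fin m → Carrier) → Carrier
  sumSupp {m} α f = sumFin m (λ k → step (lookupV α k) k)
    where
    step : ℕ → Fin m → Carrier
    step zero k = 0#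
    step (suc _) k = f k

  -- A_ω with fuel = |α|:  A(e_i) = ω_i,  A(α) = Σ_{α_i ≥ 1} A(α - e_i) for |α| ≥ 2
  Aaux : ∀ {m} → (ℕ → Carrier) → ℕ → Vec ℕ m → Carrier
  Aaux ω zero α = 0#
  Aaux ω (suc zero) α = sumSupp α (λ k → ω (suc (toℕ k)))
  Aaux ω (suc (suc s)) α = sumSupp α (λ k → Aaux ω (suc s) (decAt k α))

  A : ∀ {m} → (ℕ → Carrier) → Vec ℕ m → Carrier
  A ω α = Aaux ω (size α) α

  P : (n : ℕ) → (ω : ℕ → Carrier) → (ℕ → Carrier) → Carrier
  P n ω t = sumList (List.map (λ α → A ω α * mono t α) (partitionsVec n))

  -- Ξ(e_k) = (-1)^{k+1} t_k, with e_0 = 1 and e_k = 0 for k < 0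
  Ξe : (ℕ → Carrier) → ℤ → Carrier
  Ξe t (+ zero) = 1#
  Ξe t (+ suc k) = pow (- 1#) k * t (suc k)
  Ξe t -[1+ _ ] = 0#

  -- Schur reflect Ŝ_λ = Ξ(S_λ), with S_λ = det(e_{λ'_i - i + j}) (dual Jacobi–Trudi), evaluated at t
  schurReflect : List ℕ → (ℕ → Carrier) → Carrier
  schurReflect λp t = det (length λc)
      (λ i j → Ξe t ((+ lookup λc i) ℤ.- (+ toℕ i) ℤ.+ (+ toℕ j)))
    where
    λc = conjugate λp

  ωhook : ℕ → ℕ → Carrier
  ωhook r j with j ≤? r
  ... | Relation.Nullary.yes _ = 0#
  ... | Relation.Nullary.no _ = pow (- 1#) r

-- Write Ĥ m for the reflected complete homogeneous function, the m × m dual Jacobi–Trudi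
-- determinant det (E (1 - i + k)) with E = Ξ ∘ e.  The conjugate of the hook (n - r, 1^r),
-- n = r + 1 + d, is (r + 1, 1^d), so its Jacobi–Trudi matrix is Hessenberg; expanding along the
-- first row gives Ŝ = (-1)^r Σ_{j ≤ d} t_{r+1+j} Ĥ (d - j), and the same expansion gives
-- Ĥ w = δ_{w,0} + Σ_k t_{k+1} Ĥ (w - 1 - k).
-- On the other side, removing one unit from α in the recursion defining A_ω shows that
-- Q w = Σ_{α ⊢ w} A_ω(α) t^α satisfies Q w = Σ_k t_{k+1} (ω_{k+1} δ_{w-1-k,0} + Q (w - 1 - k)).
-- By associativity of convolution, F w = Σ_k ω_{k+1} t_{k+1} Ĥ (w - 1 - k) satisfies the same
-- recursion, so Q = F.  For ω = ω^(r) only the terms k ≥ r of F n survive, and they are the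
-- expansion of Ŝ above.
module Submission where

open import Defs
open import Level using (Level)
open import Algebra.Bundles using (CommutativeRing)
open import Data.Nat as ℕ using (ℕ; zero; suc; _∸_; _⊔_; _≤_; _<_; _≟_; _≤?_; z≤n; s≤s)
import Data.Nat.Properties as ℕₚ
open import Data.Nat.Induction using (<-rec)
open import Data.Nat.Tactic.RingSolver using (solve-∀)
open import Data.Fin using (Fin; zero; suc; toℕ; punchIn; punchOut)
import Data.Fin.Properties as Finₚ
open import Data.Integer as ℤ using (ℤ; -[1+_]; _⊖_)
import Data.Integer.Properties as ℤₚ
open import Data.Vec using (Vec; []; _∷_)
open import Data.List as List using (List; []; _∷_)
import Data.List.Properties as Listₚ
import Data.List.Relation.Unary.All.Properties as Allₚ
open import Data.Product using (_,_)
open import Relation.Nullary using (yes; no; contradiction)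
open import Relation.Binary.PropositionalEquality as ≡ using (_≡_; _≢_)

-- The conjugate of a hook

lookup-replicate : ∀ {A : Set} n (x : A) i → List.lookup (List.replicate n x) i ≡ x
lookup-replicate (suc n) x zero = ≡.refl
lookup-replicate (suc n) x (suc i) = lookup-replicate n x i

applyUpTo-replicate : ∀ {A : Set} {f : ℕ → A} {x} n → (∀ i → i < n → f i ≡ x) →
                      List.applyUpTo f n ≡ List.replicate n x
applyUpTo-replicate zero _ = ≡.refl
applyUpTo-replicate (suc n) f≡x =
  ≡.cong₂ _∷_ (f≡x 0 (s≤s z≤n)) (applyUpTo-replicate n (λ i i<n → f≡x (suc i) (s≤s i<n)))

conjugate-hook : ∀ r d → conjugate (hook (suc (r ℕ.+ d)) r) ≡ suc r ∷ List.replicate d 1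
conjugate-hook r d = begin
  conjugate ((suc (r ℕ.+ d) ∸ r) ∷ ones)
    ≡⟨ ≡.cong (λ x → conjugate (x ∷ ones)) arm ⟩
  List.map column (List.upTo (suc d ⊔ List.foldr _⊔_ 0 ones))
    ≡⟨ ≡.cong (λ m → List.map column (List.upTo m)) (ℕₚ.m≥n⇒m⊔n≡m (ℕₚ.≤-trans (max-ones r) (s≤s z≤n))) ⟩
  column 0 ∷ List.map column (List.applyUpTo suc d)
    ≡⟨ ≡.cong₂ _∷_ column-0 (≡.trans (Listₚ.map-applyUpTo suc column d) (applyUpTo-replicate d column-suc)) ⟩
  suc r ∷ List.replicate d 1 ∎
  where
  open ≡.≡-Reasoning
  ones : List ℕ
  ones = List.replicate r 1
  arm : suc (r ℕ.+ d) ∸ r ≡ suc d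
  arm = ≡.trans (ℕₚ.+-∸-assoc 1 (ℕₚ.m≤m+n r d)) (≡.cong suc (ℕₚ.m+n∸m≡n r d))
  column : ℕ → ℕ
  column i = List.length (List.filter (λ x → suc i ≤? x) (suc d ∷ ones))
  max-ones : ∀ n → List.foldr _⊔_ 0 (List.replicate n 1) ≤ 1
  max-ones zero = z≤n
  max-ones (suc n) = ℕₚ.⊔-lub ℕₚ.≤-refl (max-ones n)
  column-0 : column 0 ≡ suc r
  column-0 = ≡.cong suc (≡.trans (≡.cong List.length (Listₚ.filter-all (λ x → 1 ≤? x) (Allₚ.replicate⁺ r ℕₚ.≤-refl)))
                                 (Listₚ.length-replicate r))
  column-suc : ∀ i → i < d → column (suc i) ≡ 1
  column-suc i i<d = begin
    List.length (List.filter (λ x → suc (suc i) ≤? x) (suc d ∷ ones))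
      ≡⟨ ≡.cong List.length (Listₚ.filter-accept (λ x → suc (suc i) ≤? x) {suc d} {ones} (s≤s i<d)) ⟩
    suc (List.length (List.filter (λ x → suc (suc i) ≤? x) ones))
      ≡⟨ ≡.cong (λ xs → suc (List.length xs))
                (Listₚ.filter-none (λ x → suc (suc i) ≤? x) (Allₚ.replicate⁺ r λ { (s≤s ()) })) ⟩
    1 ∎

module _ {c ℓ : Level} (R : CommutativeRing c ℓ) where
  open CommutativeRing R hiding (zero)
  open Over R
  open import Algebra.Properties.CommutativeSemigroup +-commutativeSemigroup using (interchange)
  open import Algebra.Properties.CommutativeSemigroup *-commutativeSemigroup using (x∙yz≈y∙xz; xy∙z≈y∙xz)
  open import Algebra.Properties.Ring ring using (-1*x≈-x; -‿involutive)
  open import Relation.Binary.Reasoning.Setoid setoid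

  -- Finite sums and shifted convolution

  sumFin-cong : ∀ m {f g : Fin m → Carrier} → (∀ k → f k ≈ g k) → sumFin m f ≈ sumFin m g
  sumFin-cong zero eq = refl
  sumFin-cong (suc m) eq = +-cong (eq zero) (sumFin-cong m (λ k → eq (suc k)))

  sumFin-zero : ∀ m {f : Fin m → Carrier} → (∀ k → f k ≈ 0#) → sumFin m f ≈ 0#
  sumFin-zero zero z = refl
  sumFin-zero (suc m) z = trans (+-cong (z zero) (sumFin-zero m (λ k → z (suc k)))) (+-identityˡ 0#)

  sumFin-+ : ∀ m (f g : Fin m → Carrier) → sumFin m (λ k → f k + g k) ≈ sumFin m f + sumFin m g
  sumFin-+ zero f g = sym (+-identityˡ 0#)
  sumFin-+ (suc m) f g = trans (+-congˡ (sumFin-+ m _ _)) (interchange _ _ _ _)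

  *-distribˡ-sumFin : ∀ m x (f : Fin m → Carrier) → x * sumFin m f ≈ sumFin m (λ k → x * f k)
  *-distribˡ-sumFin zero x f = zeroʳ x
  *-distribˡ-sumFin (suc m) x f = trans (distribˡ x _ _) (+-congˡ (*-distribˡ-sumFin m x _))

  sumBelow : ℕ → (ℕ → Carrier) → Carrier
  sumBelow zero f = 0#
  sumBelow (suc n) f = f 0 + sumBelow n (λ k → f (suc k))

  sumFin≡sumBelow : ∀ n (f : ℕ → Carrier) → sumFin n (λ k → f (toℕ k)) ≡ sumBelow n f
  sumFin≡sumBelow zero f = ≡.refl
  sumFin≡sumBelow (suc n) f = ≡.cong (f 0 +_) (sumFin≡sumBelow n (λ k → f (suc k)))

  sumBelow-cong : ∀ n {f g : ℕ → Carrier} → (∀ k → k < n → f k ≈ g k) → sumBelow n f ≈ sumBelow n g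
  sumBelow-cong zero eq = refl
  sumBelow-cong (suc n) eq = +-cong (eq 0 (s≤s z≤n)) (sumBelow-cong n (λ k k<n → eq (suc k) (s≤s k<n)))

  sumBelow-zero : ∀ n {f : ℕ → Carrier} → (∀ k → f k ≈ 0#) → sumBelow n f ≈ 0#
  sumBelow-zero zero z = refl
  sumBelow-zero (suc n) z = trans (+-cong (z 0) (sumBelow-zero n (λ k → z (suc k)))) (+-identityˡ 0#)

  sumBelow-+ : ∀ n (f g : ℕ → Carrier) → sumBelow n (λ k → f k + g k) ≈ sumBelow n f + sumBelow n g
  sumBelow-+ zero f g = sym (+-identityˡ 0#)
  sumBelow-+ (suc n) f g = trans (+-congˡ (sumBelow-+ n _ _)) (interchange _ _ _ _)

  *-distribˡ-sumBelow : ∀ n x (f : ℕ → Carrier) → x * sumBelow n f ≈ sumBelow n (λ k → x * f k)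
  *-distribˡ-sumBelow zero x f = zeroʳ x
  *-distribˡ-sumBelow (suc n) x f = trans (distribˡ x _ _) (+-congˡ (*-distribˡ-sumBelow n x _))

  sumBelow-truncate : ∀ {n w} {f : ℕ → Carrier} → w ≤ n → (∀ k → w ≤ k → f k ≈ 0#) →
                      sumBelow n f ≈ sumBelow w f
  sumBelow-truncate {n} z≤n z = sumBelow-zero n (λ k → z k z≤n)
  sumBelow-truncate (s≤s w≤n) z = +-congˡ (sumBelow-truncate w≤n (λ k w≤k → z (suc k) (s≤s w≤k)))

  sumBelow-drop : ∀ a {b} {f : ℕ → Carrier} → (∀ k → k < a → f k ≈ 0#) →
                  sumBelow (a ℕ.+ b) f ≈ sumBelow b (λ k → f (a ℕ.+ k))
  sumBelow-drop zero z = refl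
  sumBelow-drop (suc a) z =
    trans (+-cong (z 0 (s≤s z≤n)) (sumBelow-drop a (λ k k<a → z (suc k) (s≤s k<a)))) (+-identityˡ _)

  sumBelow-sumFin : ∀ n {m} (f : ℕ → Fin m → Carrier) →
                    sumBelow n (λ x → sumFin m (f x)) ≈ sumFin m (λ k → sumBelow n (λ x → f x k))
  sumBelow-sumFin zero {m} f = sym (sumFin-zero m (λ _ → refl))
  sumBelow-sumFin (suc n) {m} f =
    trans (+-congˡ (sumBelow-sumFin n (λ x → f (suc x)))) (sym (sumFin-+ m (f 0) _))

  triangle : ℕ → (ℕ → ℕ → Carrier) → Carrier
  triangle w f = sumBelow w (λ k → sumBelow (w ∸ suc k) (f k))

  triangle-peel-column : ∀ w f → triangle (suc w) f ≈ sumBelow w (λ k → f k 0) + triangle w (λ k l → f k (suc l))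
  triangle-peel-column zero f = refl
  triangle-peel-column (suc w) f = begin
    (f 0 0 + sumBelow w (λ l → f 0 (suc l))) + triangle (suc w) (λ k → f (suc k))
      ≈⟨ +-congˡ (triangle-peel-column w (λ k → f (suc k))) ⟩
    (f 0 0 + sumBelow w (λ l → f 0 (suc l))) + (sumBelow w (λ k → f (suc k) 0) + corner)
      ≈⟨ interchange _ _ _ _ ⟩
    (f 0 0 + sumBelow w (λ k → f (suc k) 0)) + (sumBelow w (λ l → f 0 (suc l)) + corner) ∎
    where
    corner : Carrier
    corner = triangle w (λ k l → f (suc k) (suc l))

  triangle-transpose : ∀ w f → triangle w f ≈ triangle w (λ k l → f l k)
  triangle-transpose zero f = refl
  triangle-transpose (suc w) f = begin
    sumBelow w (f 0) + triangle w (λ k → f (suc k))     ≈⟨ +-congˡ (triangle-transpose w (λ k → f (suc k))) ⟩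
    sumBelow w (f 0) + triangle w (λ k l → f (suc l) k) ≈⟨ triangle-peel-column w (λ k l → f l k) ⟨
    triangle (suc w) (λ k l → f l k)                    ∎

  -- conv a b w is the coefficient of x^w in x · (Σ a_k x^k) · (Σ b_k x^k).
  conv : (ℕ → Carrier) → (ℕ → Carrier) → ℕ → Carrier
  conv a b w = sumBelow w (λ k → a k * b (w ∸ suc k))

  conv-congʳ : ∀ {a b b′} w → (∀ v → v < w → b v ≈ b′ v) → conv a b w ≈ conv a b′ w
  conv-congʳ w eq = sumBelow-cong w (λ k k<w → *-congˡ (eq (w ∸ suc k) (ℕₚ.∸-monoʳ-< (s≤s z≤n) k<w)))

  conv-distribʳ-+ : ∀ a b b′ w → conv a (λ v → b v + b′ v) w ≈ conv a b w + conv a b′ w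
  conv-distribʳ-+ a b b′ w = begin
    sumBelow w (λ k → a k * (b (w ∸ suc k) + b′ (w ∸ suc k)))      ≈⟨ sumBelow-cong w (λ k _ → distribˡ _ _ _) ⟩
    sumBelow w (λ k → a k * b (w ∸ suc k) + a k * b′ (w ∸ suc k)) ≈⟨ sumBelow-+ w _ _ ⟩
    conv a b w + conv a b′ w                                       ∎

  conv-exchange : ∀ a b c w → conv a (conv b c) w ≈ conv b (conv a c) w
  conv-exchange a b c w = begin
    conv a (conv b c) w
      ≈⟨ sumBelow-cong w (λ k _ → *-distribˡ-sumBelow (w ∸ suc k) (a k) _) ⟩
    triangle w (λ k l → a k * (b l * c (w ∸ suc k ∸ suc l)))
      ≈⟨ triangle-transpose w _ ⟩
    triangle w (λ k l → a l * (b k * c (w ∸ suc l ∸ suc k)))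
      ≈⟨ sumBelow-cong w (λ k _ → sumBelow-cong (w ∸ suc k) (λ l _ → swap k l)) ⟩
    triangle w (λ k l → b k * (a l * c (w ∸ suc k ∸ suc l)))
      ≈⟨ sumBelow-cong w (λ k _ → *-distribˡ-sumBelow (w ∸ suc k) (b k) _) ⟨
    conv b (conv a c) w ∎
    where
    ∸-comm : ∀ m n o → m ∸ n ∸ o ≡ m ∸ o ∸ n
    ∸-comm m n o =
      ≡.trans (ℕₚ.∸-+-assoc m n o) (≡.trans (≡.cong (m ∸_) (ℕₚ.+-comm n o)) (≡.sym (ℕₚ.∸-+-assoc m o n)))
    swap : ∀ k l → a l * (b k * c (w ∸ suc l ∸ suc k)) ≈ b k * (a l * c (w ∸ suc k ∸ suc l))
    swap k l = trans (x∙yz≈y∙xz (a l) _ _) (*-congˡ (*-congˡ (reflexive (≡.cong c (∸-comm w (suc l) (suc k))))))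

  conv-fixpoint-unique : ∀ {a g X Y : ℕ → Carrier} n →
    (∀ w → w ≤ n → X w ≈ g w + conv a X w) → (∀ w → w ≤ n → Y w ≈ g w + conv a Y w) →
    ∀ w → w ≤ n → X w ≈ Y w
  conv-fixpoint-unique {a} {g} {X} {Y} n X-fix Y-fix = <-rec (λ w → w ≤ n → X w ≈ Y w) step
    where
    step : ∀ w → (∀ {v} → v < w → v ≤ n → X v ≈ Y v) → w ≤ n → X w ≈ Y w
    step w ih w≤n = begin
      X w              ≈⟨ X-fix w w≤n ⟩
      g w + conv a X w ≈⟨ +-congˡ (conv-congʳ w (λ v v<w → ih v<w (ℕₚ.≤-trans (ℕₚ.<⇒≤ v<w) w≤n))) ⟩
      g w + conv a Y w ≈⟨ Y-fix w w≤n ⟨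
      Y w              ∎

  pow-+ : ∀ x a b → pow x (a ℕ.+ b) ≈ pow x a * pow x b
  pow-+ x zero b = sym (*-identityˡ _)
  pow-+ x (suc a) b = trans (*-congˡ (pow-+ x a b)) (sym (*-assoc _ _ _))

  sign-cancel : ∀ j x → pow (- 1#) j * (pow (- 1#) j * x) ≈ x
  sign-cancel zero x = trans (*-identityˡ _) (*-identityˡ x)
  sign-cancel (suc j) x = begin
    (- 1# * s) * ((- 1# * s) * x) ≈⟨ *-congˡ (*-assoc _ _ _) ⟩
    (- 1# * s) * (- 1# * (s * x)) ≈⟨ *-assoc _ _ _ ⟩
    - 1# * (s * (- 1# * (s * x))) ≈⟨ *-congˡ (x∙yz≈y∙xz s _ _) ⟩
    - 1# * (- 1# * (s * (s * x))) ≈⟨ *-congˡ (*-congˡ (sign-cancel j x)) ⟩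
    - 1# * (- 1# * x)             ≈⟨ trans (-1*x≈-x _) (-‿cong (-1*x≈-x x)) ⟩
    - (- x)                       ≈⟨ -‿involutive x ⟩
    x                             ∎
    where
    s : Carrier
    s = pow (- 1#) j

  sign-shift : ∀ r j x → pow (- 1#) j * (pow (- 1#) (r ℕ.+ j) * x) ≈ pow (- 1#) r * x
  sign-shift r j x = begin
    pow (- 1#) j * (pow (- 1#) (r ℕ.+ j) * x)          ≈⟨ *-congˡ (*-congʳ (pow-+ (- 1#) r j)) ⟩
    pow (- 1#) j * ((pow (- 1#) r * pow (- 1#) j) * x) ≈⟨ *-congˡ (*-assoc _ _ _) ⟩
    pow (- 1#) j * (pow (- 1#) r * (pow (- 1#) j * x)) ≈⟨ x∙yz≈y∙xz _ _ _ ⟩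
    pow (- 1#) r * (pow (- 1#) j * (pow (- 1#) j * x)) ≈⟨ *-congˡ (sign-cancel j x) ⟩
    pow (- 1#) r * x                                   ∎

  δ : ℕ → ℕ → Carrier
  δ zero zero = 1#
  δ zero (suc n) = 0#
  δ (suc m) zero = 0#
  δ (suc m) (suc n) = δ m n

  δ-diag : ∀ n → δ n n ≡ 1#
  δ-diag zero = ≡.refl
  δ-diag (suc n) = δ-diag n

  δ-≢ : ∀ {m n} → m ≢ n → δ m n ≡ 0#
  δ-≢ {zero} {zero} m≢n = contradiction ≡.refl m≢n
  δ-≢ {zero} {suc n} _ = ≡.refl
  δ-≢ {suc m} {zero} _ = ≡.refl
  δ-≢ {suc m} {suc n} m≢n = δ-≢ (λ m≡n → m≢n (≡.cong suc m≡n))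

  δ-+ˡ : ∀ a m n → δ (a ℕ.+ m) (a ℕ.+ n) ≡ δ m n
  δ-+ˡ zero m n = ≡.refl
  δ-+ˡ (suc a) m n = δ-+ˡ a m n

  δ-<-zero : ∀ {m n} → n < m → ∀ x → δ m n * x ≈ 0#
  δ-<-zero n<m x = trans (*-congʳ (reflexive (δ-≢ (ℕₚ.>⇒≢ n<m)))) (zeroˡ x)

  -- Determinants

  minor : ∀ {m} → (Fin (suc m) → Fin (suc m) → Carrier) → Fin (suc m) → Fin m → Fin m → Carrier
  minor M j i k = M (suc i) (punchIn j k)

  laplaceTerm : ∀ m → (Fin (suc m) → Fin (suc m) → Carrier) → Fin (suc m) → Carrier
  laplaceTerm m M j = pow (- 1#) (toℕ j) * M zero j * det m (minor M j)

  det-cong : ∀ m {M N : Fin m → Fin m → Carrier} → (∀ i j → M i j ≈ N i j) → det m M ≈ det m N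
  det-cong zero eq = refl
  det-cong (suc m) {M} {N} eq = sumFin-cong (suc m) term
    where
    term : ∀ j → laplaceTerm m M j ≈ laplaceTerm m N j
    term j = *-cong (*-congˡ (eq zero j)) (det-cong m (λ i k → eq (suc i) (punchIn j k)))

  det-zero-column : ∀ m (M : Fin m → Fin m → Carrier) c → (∀ i → M i c ≈ 0#) → det m M ≈ 0#
  det-zero-column (suc m) M c z = sumFin-zero (suc m) term
    where
    term : ∀ j → laplaceTerm m M j ≈ 0#
    term j with j Finₚ.≟ c
    ... | yes ≡.refl = trans (*-congʳ (trans (*-congˡ (z zero)) (zeroʳ _))) (zeroˡ _)
    ... | no j≢c = trans (*-congˡ (det-zero-column m (minor M j) (punchOut j≢c) column)) (zeroʳ _)
      where
      column : ∀ i → minor M j i (punchOut j≢c) ≈ 0#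
      column i = trans (reflexive (≡.cong (M (suc i)) (Finₚ.punchIn-punchOut j≢c))) (z (suc i))

  laplaceTerm-zero : ∀ m (M : Fin (suc m) → Fin (suc m) → Carrier) → M zero zero ≈ 1# →
                     laplaceTerm m M zero ≈ det m (minor M zero)
  laplaceTerm-zero m M one = trans (*-congʳ (trans (*-identityˡ _) one)) (*-identityˡ _)

  det-unitFirstColumn : ∀ m (M : Fin (suc m) → Fin (suc m) → Carrier) →
    M zero zero ≈ 1# → (∀ i → M (suc i) zero ≈ 0#) → det (suc m) M ≈ det m (minor M zero)
  det-unitFirstColumn zero M one _ = trans (+-identityʳ _) (laplaceTerm-zero zero M one)
  det-unitFirstColumn (suc m) M one column =
    trans (+-cong (laplaceTerm-zero (suc m) M one) (sumFin-zero (suc m) vanish)) (+-identityʳ _)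
    where
    vanish : ∀ l → laplaceTerm (suc m) M (suc l) ≈ 0#
    vanish l = trans (*-congˡ (det-zero-column (suc m) (minor M (suc l)) zero column)) (zeroʳ _)

  module Hessenberg (e : ℤ → Carrier) (e-zero : e (ℤ.+ 0) ≈ 1#) (e-neg : ∀ n → e -[1+ n ] ≈ 0#) where

    -- For e = Ξe t this is the dual Jacobi–Trudi determinant of the one-row partition (m), i.e. Ξ (h_m).
    Ĥ : ℕ → Carrier
    Ĥ m = det m (λ i k → e (suc (toℕ k) ⊖ toℕ i))

    hessenberg : ∀ m → (ℕ → Carrier) → Fin (suc m) → Fin (suc m) → Carrier
    hessenberg m a zero k = a (toℕ k)
    hessenberg m a (suc i) k = e (toℕ k ⊖ toℕ i)

    det-minor-hessenberg : ∀ m (j : Fin (suc m)) → det m (λ i k → e (toℕ (punchIn j k) ⊖ toℕ i)) ≈ Ĥ (m ∸ toℕ j)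
    det-minor-hessenberg m zero = refl
    det-minor-hessenberg (suc m) (suc j) = begin
      det (suc m) M                                  ≈⟨ det-unitFirstColumn m M e-zero (λ i → e-neg (toℕ i)) ⟩
      det m (minor M zero)                           ≈⟨ det-cong m (λ i k → reflexive (≡.cong e (ℤₚ.[1+m]⊖[1+n]≡m⊖n _ (toℕ i)))) ⟩
      det m (λ i k → e (toℕ (punchIn j k) ⊖ toℕ i)) ≈⟨ det-minor-hessenberg m j ⟩
      Ĥ (m ∸ toℕ j)                                  ∎
      where
      M : Fin (suc m) → Fin (suc m) → Carrier
      M i k = e (toℕ (punchIn (suc j) k) ⊖ toℕ i)

    det-hessenberg : ∀ m a → det (suc m) (hessenberg m a) ≈ sumBelow (suc m) (λ j → pow (- 1#) j * a j * Ĥ (m ∸ j))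
    det-hessenberg m a = trans (sumFin-cong (suc m) term) (reflexive (sumFin≡sumBelow (suc m) expansion))
      where
      expansion : ℕ → Carrier
      expansion j = pow (- 1#) j * a j * Ĥ (m ∸ j)
      term : ∀ j → laplaceTerm m (hessenberg m a) j ≈ expansion (toℕ j)
      term j = *-congˡ (det-minor-hessenberg m j)

    Ĥ-suc : ∀ m → Ĥ (suc m) ≈ sumBelow (suc m) (λ j → pow (- 1#) j * e (ℤ.+ suc j) * Ĥ (m ∸ j))
    Ĥ-suc m = trans (det-cong (suc m) entry) (det-hessenberg m (λ j → e (ℤ.+ suc j)))
      where
      entry : ∀ i k → e (suc (toℕ k) ⊖ toℕ i) ≈ hessenberg m (λ j → e (ℤ.+ suc j)) i k
      entry zero k = refl
      entry (suc i) k = reflexive (≡.cong e (ℤₚ.[1+m]⊖[1+n]≡m⊖n (toℕ k) (toℕ i)))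

  -- Sums over the box [0, b]^m of exponent vectors

  sumList-++ : ∀ {A : Set} (f : A → Carrier) xs ys →
               sumList (List.map f (xs List.++ ys)) ≈ sumList (List.map f xs) + sumList (List.map f ys)
  sumList-++ f [] ys = sym (+-identityˡ _)
  sumList-++ f (x ∷ xs) ys = trans (+-congˡ (sumList-++ f xs ys)) (sym (+-assoc _ _ _))

  sumList-concatMap : ∀ {A B : Set} (f : B → Carrier) (g : A → List B) xs →
    sumList (List.map f (List.concatMap g xs)) ≈ sumList (List.map (λ x → sumList (List.map f (g x))) xs)
  sumList-concatMap f g [] = refl
  sumList-concatMap f g (x ∷ xs) = trans (sumList-++ f (g x) _) (+-congˡ (sumList-concatMap f g xs))

  sumList-applyUpTo : ∀ (f : ℕ → Carrier) g n → sumList (List.map f (List.applyUpTo g n)) ≡ sumBelow n (λ k → f (g k))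
  sumList-applyUpTo f g zero = ≡.refl
  sumList-applyUpTo f g (suc n) = ≡.cong (f (g 0) +_) (sumList-applyUpTo f (λ k → g (suc k)) n)

  sumList-filter : ∀ {A : Set} (g : A → ℕ) w (f : A → Carrier) xs →
    sumList (List.map f (List.filter (λ x → g x ≟ w) xs)) ≈ sumList (List.map (λ x → δ (g x) w * f x) xs)
  sumList-filter g w f [] = refl
  sumList-filter g w f (x ∷ xs) with g x ≟ w
  ... | yes gx≡w = begin
    sumList (List.map f (List.filter (λ x → g x ≟ w) (x ∷ xs)))
      ≡⟨ ≡.cong (λ ys → sumList (List.map f ys)) (Listₚ.filter-accept (λ x → g x ≟ w) gx≡w) ⟩
    f x + sumList (List.map f (List.filter (λ x → g x ≟ w) xs))
      ≈⟨ +-cong (sym (trans (*-congʳ (reflexive (≡.trans (≡.cong (λ y → δ y w) gx≡w) (δ-diag w)))) (*-identityˡ _)))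
                (sumList-filter g w f xs) ⟩
    δ (g x) w * f x + sumList (List.map (λ x → δ (g x) w * f x) xs) ∎
  ... | no gx≢w = begin
    sumList (List.map f (List.filter (λ x → g x ≟ w) (x ∷ xs)))
      ≡⟨ ≡.cong (λ ys → sumList (List.map f ys)) (Listₚ.filter-reject (λ x → g x ≟ w) gx≢w) ⟩
    sumList (List.map f (List.filter (λ x → g x ≟ w) xs)) ≈⟨ sumList-filter g w f xs ⟩
    sumList (List.map (λ x → δ (g x) w * f x) xs)          ≈⟨ +-identityˡ _ ⟨
    0# + _                                                ≈⟨ +-congʳ (trans (*-congʳ (reflexive (δ-≢ gx≢w))) (zeroˡ _)) ⟨
    δ (g x) w * f x + _                                   ∎

  boxSum : ℕ → ∀ m → (Vec ℕ m → Carrier) → Carrier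
  boxSum b zero f = f []
  boxSum b (suc m) f = sumBelow (suc b) (λ x → boxSum b m (λ α → f (x ∷ α)))

  sumList-allVecs : ∀ b m (f : Vec ℕ m → Carrier) → sumList (List.map f (allVecs b m)) ≈ boxSum b m f
  sumList-allVecs b zero f = +-identityʳ _
  sumList-allVecs b (suc m) f = begin
    sumList (List.map f (List.concatMap prefixed (List.upTo (suc b))))
      ≈⟨ sumList-concatMap f prefixed (List.upTo (suc b)) ⟩
    sumList (List.map (λ x → sumList (List.map f (prefixed x))) (List.upTo (suc b)))
      ≡⟨ sumList-applyUpTo _ (λ x → x) (suc b) ⟩
    sumBelow (suc b) (λ x → sumList (List.map f (prefixed x)))
      ≈⟨ sumBelow-cong (suc b) (λ x _ → trans (reflexive (≡.cong sumList (≡.sym (Listₚ.map-∘ {g = f} (allVecs b m)))))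
                                              (sumList-allVecs b m (λ α → f (x ∷ α)))) ⟩
    boxSum b (suc m) f ∎
    where
    prefixed : ℕ → List (Vec ℕ (suc m))
    prefixed x = List.map (x ∷_) (allVecs b m)

  boxSum-cong : ∀ {b} m {f g : Vec ℕ m → Carrier} → (∀ α → f α ≈ g α) → boxSum b m f ≈ boxSum b m g
  boxSum-cong zero eq = eq []
  boxSum-cong {b} (suc m) eq = sumBelow-cong (suc b) (λ x _ → boxSum-cong {b} m (λ α → eq (x ∷ α)))

  boxSum-zero : ∀ {b} m {f : Vec ℕ m → Carrier} → (∀ α → f α ≈ 0#) → boxSum b m f ≈ 0#
  boxSum-zero zero z = z []
  boxSum-zero {b} (suc m) z = sumBelow-zero (suc b) (λ x → boxSum-zero {b} m (λ α → z (x ∷ α)))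

  boxSum-+ : ∀ {b} m (f g : Vec ℕ m → Carrier) → boxSum b m (λ α → f α + g α) ≈ boxSum b m f + boxSum b m g
  boxSum-+ zero f g = refl
  boxSum-+ {b} (suc m) f g =
    trans (sumBelow-cong (suc b) (λ x _ → boxSum-+ {b} m (λ α → f (x ∷ α)) (λ α → g (x ∷ α))))
          (sumBelow-+ (suc b) (λ x → boxSum b m (λ α → f (x ∷ α))) (λ x → boxSum b m (λ α → g (x ∷ α))))

  *-distribˡ-boxSum : ∀ {b} m x (f : Vec ℕ m → Carrier) → x * boxSum b m f ≈ boxSum b m (λ α → x * f α)
  *-distribˡ-boxSum zero x f = refl
  *-distribˡ-boxSum {b} (suc m) x f = trans (*-distribˡ-sumBelow (suc b) x (λ y → boxSum b m (λ α → f (y ∷ α))))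
                                            (sumBelow-cong (suc b) (λ y _ → *-distribˡ-boxSum {b} m x (λ α → f (y ∷ α))))

  boxSum-sumFin : ∀ {b} m {n} (f : Vec ℕ m → Fin n → Carrier) →
                  boxSum b m (λ α → sumFin n (f α)) ≈ sumFin n (λ k → boxSum b m (λ α → f α k))
  boxSum-sumFin zero f = refl
  boxSum-sumFin {b} (suc m) f = trans (sumBelow-cong (suc b) (λ x _ → boxSum-sumFin {b} m (λ α → f (x ∷ α))))
                                      (sumBelow-sumFin (suc b) (λ x k → boxSum b m (λ α → f (x ∷ α) k)))

  ifPos : ℕ → Carrier → Carrier
  ifPos zero _ = 0#
  ifPos (suc _) v = v

  *-ifPos : ∀ n x y → x * ifPos n y ≈ ifPos n (x * y)
  *-ifPos zero x y = zeroʳ x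
  *-ifPos (suc n) x y = refl

  -- Substituting β = α - e_k: the vectors β with β_k = b have no preimage in the box,
  -- and their terms vanish because their shifted weight exceeds b.
  boxSum-shift : ∀ {b m} (k : Fin m) i (G : ℕ → Vec ℕ m → Carrier) → (∀ x β → b < x → G x β ≈ 0#) →
    boxSum b m (λ α → ifPos (lookupV α k) (G (weightFrom (suc i) α) (decAt k α))) ≈
    boxSum b m (λ β → G (suc i ℕ.+ toℕ k ℕ.+ weightFrom (suc i) β) β)
  boxSum-shift {b} {suc m} zero i G vanish = begin
    boxSum b m (λ α → 0#) + sumBelow b shifted   ≈⟨ +-congʳ (boxSum-zero {b} m (λ _ → refl)) ⟩
    0# + sumBelow b shifted                      ≈⟨ +-identityˡ _ ⟩
    sumBelow b shifted                           ≈⟨ sumBelow-truncate (ℕₚ.n≤1+n b) beyond ⟨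
    sumBelow (suc b) shifted                     ≈⟨ sumBelow-cong (suc b) (λ y _ → boxSum-cong {b} m (λ α → reflexive
                                                      (≡.cong (λ x → G x (y ∷ α)) (arith i y (W α))))) ⟩
    boxSum b (suc m) (λ β → G (suc i ℕ.+ 0 ℕ.+ weightFrom (suc i) β) β) ∎
    where
    W : Vec ℕ m → ℕ
    W = weightFrom (suc (suc i))
    shifted : ℕ → Carrier
    shifted y = boxSum b m (λ α → G (suc i ℕ.* suc y ℕ.+ W α) (y ∷ α))
    arith : ∀ i y w → suc i ℕ.* suc y ℕ.+ w ≡ suc i ℕ.+ 0 ℕ.+ (suc i ℕ.* y ℕ.+ w)
    arith = solve-∀
    beyond : ∀ y → b ≤ y → shifted y ≈ 0#
    beyond y b≤y = boxSum-zero {b} m (λ α → vanish _ _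
      (ℕₚ.≤-trans (s≤s b≤y) (ℕₚ.≤-trans (ℕₚ.m≤m+n (suc y) _) (ℕₚ.m≤m+n _ (W α)))))
  boxSum-shift {b} {suc m} (suc k) i G vanish = sumBelow-cong (suc b) (λ x _ → begin
    boxSum b m (λ α → ifPos (lookupV α k) (G (suc i ℕ.* x ℕ.+ W α) (x ∷ decAt k α)))
      ≈⟨ boxSum-shift k (suc i) (λ y β → G (suc i ℕ.* x ℕ.+ y) (x ∷ β))
                      (λ y β b<y → vanish _ _ (ℕₚ.≤-trans b<y (ℕₚ.m≤n+m y _))) ⟩
    boxSum b m (λ β → G (suc i ℕ.* x ℕ.+ (suc (suc i) ℕ.+ toℕ k ℕ.+ W β)) (x ∷ β))
      ≈⟨ boxSum-cong {b} m (λ β → reflexive (≡.cong (λ y → G y (x ∷ β)) (arith i x (toℕ k) (W β)))) ⟩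
    boxSum b m (λ β → G (suc i ℕ.+ suc (toℕ k) ℕ.+ (suc i ℕ.* x ℕ.+ W β)) (x ∷ β)) ∎)
    where
    W : Vec ℕ m → ℕ
    W = weightFrom (suc (suc i))
    arith : ∀ i x k w → suc i ℕ.* x ℕ.+ (suc (suc i) ℕ.+ k ℕ.+ w) ≡ suc i ℕ.+ suc k ℕ.+ (suc i ℕ.* x ℕ.+ w)
    arith = solve-∀

  boxSum-δ-origin : ∀ {b} m (t : ℕ → Carrier) i v →
    boxSum b m (λ β → δ (weightFrom i β) v * (δ (size β) 0 * monoFrom t i β)) ≈ δ 0 v
  boxSum-δ-origin zero t i v = trans (*-congˡ (*-identityˡ 1#)) (*-identityʳ _)
  boxSum-δ-origin {b} (suc m) t i v = begin
    boxSum b m (λ β → δ (i ℕ.* 0 ℕ.+ W β) v * (δ (size β) 0 * (1# * monoFrom t (suc i) β))) + _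
      ≈⟨ +-cong (boxSum-cong {b} m (λ β → *-cong (reflexive (≡.cong (λ x → δ (x ℕ.+ W β) v) (ℕₚ.*-zeroʳ i)))
                                                 (*-congˡ (*-identityˡ _))))
                (sumBelow-zero b (λ y → boxSum-zero {b} m (λ β → trans (*-congˡ (zeroˡ _)) (zeroʳ _)))) ⟩
    boxSum b m (λ β → δ (W β) v * (δ (size β) 0 * monoFrom t (suc i) β)) + 0#
      ≈⟨ +-identityʳ _ ⟩
    boxSum b m (λ β → δ (W β) v * (δ (size β) 0 * monoFrom t (suc i) β))
      ≈⟨ boxSum-δ-origin m t (suc i) v ⟩
    δ 0 v ∎
    where
    W : Vec ℕ m → ℕ
    W = weightFrom (suc i)

  -- The recursion for A_ω

  size-decAt : ∀ {m} (α : Vec ℕ m) k {a} → lookupV α k ≡ suc a → size α ≡ suc (size (decAt k α))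
  size-decAt (x ∷ α) zero eq rewrite eq = ≡.refl
  size-decAt (x ∷ α) (suc k) eq = ≡.trans (≡.cong (x ℕ.+_) (size-decAt α k eq)) (ℕₚ.+-suc x _)

  mono-decAt : ∀ {m} (t : ℕ → Carrier) i (α : Vec ℕ m) k {a} → lookupV α k ≡ suc a →
               monoFrom t i α ≈ t (i ℕ.+ toℕ k) * monoFrom t i (decAt k α)
  mono-decAt t i (x ∷ α) zero eq rewrite eq =
    trans (*-assoc _ _ _) (*-congʳ (reflexive (≡.cong t (≡.sym (ℕₚ.+-identityʳ i)))))
  mono-decAt t i (x ∷ α) (suc k) eq =
    trans (*-congˡ (mono-decAt t (suc i) α k eq))
          (trans (x∙yz≈y∙xz _ _ _) (*-congʳ (reflexive (≡.cong t (≡.sym (ℕₚ.+-suc i (toℕ k)))))))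

  -- `sumSupp` sums a helper local to its definition, which cannot be named here; unifying
  -- `sumSupp α f ≡ sumFin m X` recovers it as X, so that `with` can split on its argument.
  summandOf : ∀ {m} {x : Carrier} {X : Fin m → Carrier} → x ≡ sumFin m X → Fin m → Carrier
  summandOf {X = X} _ = X

  sumSupp-ifPos : ∀ {m} (α : Vec ℕ m) f → sumSupp α f ≈ sumFin m (λ k → ifPos (lookupV α k) (f k))
  sumSupp-ifPos {m} α f = sumFin-cong m pointwise
    where
    pointwise : ∀ k → summandOf {x = sumSupp α f} ≡.refl k ≈ ifPos (lookupV α k) (f k)
    pointwise k with lookupV α k
    ... | zero = refl
    ... | suc _ = refl

  module _ (ω : ℕ → Carrier) where

    -- A_ω with its value 0 at the zero vector replaced by x: with x = ω_i the recursion
    -- A_ω(α) = Σ_{α_i ≥ 1} A⁺ ω_i (α - e_i) then also covers the base case |α| = 1.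
    A⁺ : ∀ {m} → Carrier → Vec ℕ m → Carrier
    A⁺ x β = δ (size β) 0 * x + A ω β

    A⁺-empty : ∀ {m} x (β : Vec ℕ m) → size β ≡ 0 → A⁺ x β ≈ x
    A⁺-empty x β eq rewrite eq = trans (+-identityʳ _) (*-identityˡ x)

    A⁺-nonempty : ∀ {m} x (β : Vec ℕ m) {s} → size β ≡ suc s → A⁺ x β ≈ Aaux ω (suc s) β
    A⁺-nonempty x β eq rewrite eq = trans (+-congʳ (zeroˡ x)) (+-identityˡ _)

    Aaux-unfold : ∀ {m} s (α : Vec ℕ m) → size α ≡ s →
      Aaux ω s α ≈ sumFin m (λ k → ifPos (lookupV α k) (A⁺ (ω (suc (toℕ k))) (decAt k α)))
    Aaux-unfold {m} zero α size≡0 = sym (sumFin-zero m term)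
      where
      term : ∀ k → ifPos (lookupV α k) (A⁺ (ω (suc (toℕ k))) (decAt k α)) ≈ 0#
      term k with lookupV α k in eq
      ... | zero = refl
      ... | suc _ = contradiction (≡.trans (≡.sym size≡0) (size-decAt α k eq)) ℕₚ.0≢1+n
    Aaux-unfold {m} (suc zero) α size≡1 = trans (sumSupp-ifPos α _) (sumFin-cong m term)
      where
      term : ∀ k → ifPos (lookupV α k) (ω (suc (toℕ k))) ≈ ifPos (lookupV α k) (A⁺ (ω (suc (toℕ k))) (decAt k α))
      term k with lookupV α k in eq
      ... | zero = refl
      ... | suc _ = sym (A⁺-empty _ (decAt k α) (ℕₚ.suc-injective (≡.trans (≡.sym (size-decAt α k eq)) size≡1)))
    Aaux-unfold {m} (suc (suc s)) α size≡ = trans (sumSupp-ifPos α _) (sumFin-cong m term)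
      where
      term : ∀ k → ifPos (lookupV α k) (Aaux ω (suc s) (decAt k α)) ≈
                   ifPos (lookupV α k) (A⁺ (ω (suc (toℕ k))) (decAt k α))
      term k with lookupV α k in eq
      ... | zero = refl
      ... | suc _ = sym (A⁺-nonempty _ (decAt k α) (ℕₚ.suc-injective (≡.trans (≡.sym (size-decAt α k eq)) size≡)))

  module _ (t : ℕ → Carrier) where
    open Hessenberg (Ξe t) refl (λ _ → refl)

    t⁺ : ℕ → Carrier
    t⁺ k = t (suc k)

    Ĥ-fixpoint : ∀ w → Ĥ w ≈ δ 0 w + conv t⁺ Ĥ w
    Ĥ-fixpoint zero = sym (+-identityʳ 1#)
    Ĥ-fixpoint (suc m) = begin
      Ĥ (suc m)
        ≈⟨ Ĥ-suc m ⟩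
      sumBelow (suc m) (λ j → pow (- 1#) j * Ξe t (ℤ.+ suc j) * Ĥ (m ∸ j))
        ≈⟨ sumBelow-cong (suc m) (λ j _ → *-congʳ {Ĥ (m ∸ j)} (sign-cancel j (t (suc j)))) ⟩
      conv t⁺ Ĥ (suc m)
        ≈⟨ +-identityˡ _ ⟨
      0# + conv t⁺ Ĥ (suc m) ∎

    module _ (ω : ℕ → Carrier) where

      ωt⁺ : ℕ → Carrier
      ωt⁺ k = t (suc k) * ω (suc k)

      Amono⁺ : ∀ {m} → ℕ → Vec ℕ m → Carrier
      Amono⁺ k β = A⁺ ω (ω (suc k)) β * mono t β

      A-mono-unfold : ∀ {m} (α : Vec ℕ m) →
        A ω α * mono t α ≈ sumFin m (λ k → ifPos (lookupV α k) (t⁺ (toℕ k) * Amono⁺ (toℕ k) (decAt k α)))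
      A-mono-unfold {m} α = begin
        A ω α * mono t α
          ≈⟨ trans (*-congʳ (Aaux-unfold ω (size α) α ≡.refl)) (*-comm _ _) ⟩
        mono t α * sumFin m (λ k → ifPos (lookupV α k) (A⁺ ω (ω (suc (toℕ k))) (decAt k α)))
          ≈⟨ trans (*-distribˡ-sumFin m _ _) (sumFin-cong m term) ⟩
        sumFin m (λ k → ifPos (lookupV α k) (t⁺ (toℕ k) * Amono⁺ (toℕ k) (decAt k α))) ∎
        where
        term : ∀ k → mono t α * ifPos (lookupV α k) (A⁺ ω (ω (suc (toℕ k))) (decAt k α)) ≈
                     ifPos (lookupV α k) (t⁺ (toℕ k) * Amono⁺ (toℕ k) (decAt k α))
        term k with lookupV α k in eq
        ... | zero = zeroʳ _
        ... | suc _ = trans (*-congʳ (mono-decAt t 1 α k eq)) (trans (*-assoc _ _ _) (*-congˡ (*-comm _ _)))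

      -- For w ≤ b every α ⊢ w lies in the box, so boxedP b w is P_{w,ω}.
      boxedP : ℕ → ℕ → Carrier
      boxedP b w = boxSum b b (λ α → δ (weight α) w * (A ω α * mono t α))

      P≈boxedP : ∀ n → P n ω t ≈ boxedP n n
      P≈boxedP n = trans (sumList-filter weight n _ (allVecs n n)) (sumList-allVecs n n _)

      boxedP-peel : ∀ {b w} → w ≤ b →
        boxedP b w ≈ sumBelow b (λ k → boxSum b b (λ β → δ (suc (k ℕ.+ weight β)) w * (t⁺ k * Amono⁺ k β)))
      boxedP-peel {b} {w} w≤b = begin
        boxedP b w
          ≈⟨ boxSum-cong {b} b (λ α → trans (*-congˡ (A-mono-unfold α))
                                (trans (*-distribˡ-sumFin b _ _) (sumFin-cong b (λ k → *-ifPos (lookupV α k) _ _)))) ⟩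
        boxSum b b (λ α → sumFin b (λ k → ifPos (lookupV α k) (G (toℕ k) (weight α) (decAt k α))))
          ≈⟨ boxSum-sumFin {b} b (λ α k → ifPos (lookupV α k) (G (toℕ k) (weight α) (decAt k α))) ⟩
        sumFin b (λ k → boxSum b b (λ α → ifPos (lookupV α k) (G (toℕ k) (weight α) (decAt k α))))
          ≈⟨ sumFin-cong b (λ k → boxSum-shift k 0 (G (toℕ k)) (λ x β b<x → δ-<-zero (ℕₚ.≤-<-trans w≤b b<x) _)) ⟩
        sumFin b (λ k → boxSum b b (λ β → G (toℕ k) (suc (toℕ k ℕ.+ weight β)) β))
          ≡⟨ sumFin≡sumBelow b (λ k → boxSum b b (λ β → G k (suc (k ℕ.+ weight β)) β)) ⟩
        sumBelow b (λ k → boxSum b b (λ β → G k (suc (k ℕ.+ weight β)) β)) ∎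
        where
        G : ℕ → ℕ → Vec ℕ b → Carrier
        G k x β = δ x w * (t⁺ k * Amono⁺ k β)

      boxedP-peel-term : ∀ {b w k} → k < w →
        boxSum b b (λ β → δ (suc (k ℕ.+ weight β)) w * (t⁺ k * Amono⁺ k β)) ≈
        t⁺ k * (ω (suc k) * δ 0 (w ∸ suc k) + boxedP b (w ∸ suc k))
      boxedP-peel-term {b} {w} {k} k<w = begin
        boxSum b b (λ β → δ (suc (k ℕ.+ weight β)) w * (t⁺ k * Amono⁺ k β))
          ≈⟨ boxSum-cong {b} b (λ β → trans (*-congʳ (reflexive (δ-shift (weight β)))) (expand _ _ _ _ _ _)) ⟩
        boxSum b b (λ β → t⁺ k * (o * origin β + δ (weight β) v * (A ω β * mono t β)))
          ≈⟨ *-distribˡ-boxSum {b} b (t⁺ k) _ ⟨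
        t⁺ k * boxSum b b (λ β → o * origin β + δ (weight β) v * (A ω β * mono t β))
          ≈⟨ *-congˡ (boxSum-+ {b} b _ _) ⟩
        t⁺ k * (boxSum b b (λ β → o * origin β) + boxedP b v)
          ≈⟨ *-congˡ (+-congʳ (trans (sym (*-distribˡ-boxSum {b} b o origin)) (*-congˡ (boxSum-δ-origin {b} b t 1 v)))) ⟩
        t⁺ k * (o * δ 0 v + boxedP b v) ∎
        where
        o : Carrier
        o = ω (suc k)
        v : ℕ
        v = w ∸ suc k
        origin : Vec ℕ b → Carrier
        origin β = δ (weight β) v * (δ (size β) 0 * mono t β)
        δ-shift : ∀ x → δ (suc (k ℕ.+ x)) w ≡ δ x v
        δ-shift x = ≡.trans (≡.cong (δ (suc k ℕ.+ x)) (≡.sym (ℕₚ.m+[n∸m]≡n k<w))) (δ-+ˡ (suc k) x v)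
        expand : ∀ d s z x a m → d * (s * ((z * x + a) * m)) ≈ s * (x * (d * (z * m)) + d * (a * m))
        expand d s z x a m = begin
          d * (s * ((z * x + a) * m))           ≈⟨ x∙yz≈y∙xz d s _ ⟩
          s * (d * ((z * x + a) * m))           ≈⟨ *-congˡ (*-congˡ (distribʳ m (z * x) a)) ⟩
          s * (d * (z * x * m + a * m))         ≈⟨ *-congˡ (distribˡ d _ _) ⟩
          s * (d * (z * x * m) + d * (a * m))   ≈⟨ *-congˡ (+-congʳ (*-congˡ (trans (*-assoc z x m) (x∙yz≈y∙xz z x m)))) ⟩
          s * (d * (x * (z * m)) + d * (a * m)) ≈⟨ *-congˡ (+-congʳ (x∙yz≈y∙xz d x _)) ⟩
          s * (x * (d * (z * m)) + d * (a * m)) ∎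

      boxedP-fixpoint : ∀ {b w} → w ≤ b → boxedP b w ≈ conv ωt⁺ (δ 0) w + conv t⁺ (boxedP b) w
      boxedP-fixpoint {b} {w} w≤b = begin
        boxedP b w
          ≈⟨ boxedP-peel w≤b ⟩
        sumBelow b term
          ≈⟨ sumBelow-truncate w≤b (λ k w≤k → boxSum-zero {b} b (λ β → δ-<-zero (s≤s (ℕₚ.≤-trans w≤k (ℕₚ.m≤m+n k _))) _)) ⟩
        sumBelow w term
          ≈⟨ sumBelow-cong w (λ k k<w → trans (boxedP-peel-term {b} k<w)
                                              (trans (distribˡ _ _ _) (+-congʳ (sym (*-assoc _ _ _))))) ⟩
        sumBelow w (λ k → ωt⁺ k * δ 0 (w ∸ suc k) + t⁺ k * boxedP b (w ∸ suc k))
          ≈⟨ sumBelow-+ w _ _ ⟩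
        conv ωt⁺ (δ 0) w + conv t⁺ (boxedP b) w ∎
        where
        term : ℕ → Carrier
        term k = boxSum b b (λ β → δ (suc (k ℕ.+ weight β)) w * (t⁺ k * Amono⁺ k β))

      conv-Ĥ-fixpoint : ∀ w → conv ωt⁺ Ĥ w ≈ conv ωt⁺ (δ 0) w + conv t⁺ (conv ωt⁺ Ĥ) w
      conv-Ĥ-fixpoint w = begin
        conv ωt⁺ Ĥ w                              ≈⟨ conv-congʳ w (λ v _ → Ĥ-fixpoint v) ⟩
        conv ωt⁺ (λ v → δ 0 v + conv t⁺ Ĥ v) w    ≈⟨ conv-distribʳ-+ ωt⁺ (δ 0) (conv t⁺ Ĥ) w ⟩
        conv ωt⁺ (δ 0) w + conv ωt⁺ (conv t⁺ Ĥ) w ≈⟨ +-congˡ (conv-exchange ωt⁺ t⁺ Ĥ w) ⟩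
        conv ωt⁺ (δ 0) w + conv t⁺ (conv ωt⁺ Ĥ) w ∎

      boxedP≈conv-Ĥ : ∀ {b w} → w ≤ b → boxedP b w ≈ conv ωt⁺ Ĥ w
      boxedP≈conv-Ĥ {b} = conv-fixpoint-unique b (λ _ → boxedP-fixpoint) (λ w _ → conv-Ĥ-fixpoint w) _

    module _ (r : ℕ) where

      hookExpansion : ℕ → Carrier
      hookExpansion d = pow (- 1#) r * sumBelow (suc d) (λ j → t (suc (r ℕ.+ j)) * Ĥ (d ∸ j))

      ωhook-≤ : ∀ {j} → j ≤ r → ωhook r j ≈ 0#
      ωhook-≤ {j} j≤r with j ≤? r
      ... | yes _ = refl
      ... | no j≰r = contradiction j≤r j≰r

      ωhook-> : ∀ {j} → r < j → ωhook r j ≈ pow (- 1#) r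
      ωhook-> {j} r<j with j ≤? r
      ... | yes j≤r = contradiction r<j (ℕₚ.≤⇒≯ j≤r)
      ... | no _ = refl

      conv-ωhook-Ĥ : ∀ d → conv (ωt⁺ (ωhook r)) Ĥ (suc (r ℕ.+ d)) ≈ hookExpansion d
      conv-ωhook-Ĥ d = begin
        sumBelow (suc (r ℕ.+ d)) term
          ≡⟨ ≡.cong (λ n → sumBelow n term) (≡.sym (ℕₚ.+-suc r d)) ⟩
        sumBelow (r ℕ.+ suc d) term
          ≈⟨ sumBelow-drop r (λ k k<r → trans (*-congʳ (trans (*-congˡ (ωhook-≤ k<r)) (zeroʳ _))) (zeroˡ _)) ⟩
        sumBelow (suc d) (λ j → term (r ℕ.+ j))
          ≈⟨ sumBelow-cong (suc d) (λ j _ → beyond-r j) ⟩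
        sumBelow (suc d) (λ j → pow (- 1#) r * (t (suc (r ℕ.+ j)) * Ĥ (d ∸ j)))
          ≈⟨ *-distribˡ-sumBelow (suc d) (pow (- 1#) r) (λ j → t (suc (r ℕ.+ j)) * Ĥ (d ∸ j)) ⟨
        hookExpansion d ∎
        where
        term : ℕ → Carrier
        term k = ωt⁺ (ωhook r) k * Ĥ (r ℕ.+ d ∸ k)
        beyond-r : ∀ j → term (r ℕ.+ j) ≈ pow (- 1#) r * (t (suc (r ℕ.+ j)) * Ĥ (d ∸ j))
        beyond-r j = trans (*-cong (*-congˡ (ωhook-> (s≤s (ℕₚ.m≤m+n r j))))
                                   (reflexive (≡.cong Ĥ (ℕₚ.[m+n]∸[m+o]≡n∸o r d j))))
                           (xy∙z≈y∙xz _ _ _)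

      jacobiTrudi : (λc : List ℕ) → Fin (List.length λc) → Fin (List.length λc) → Carrier
      jacobiTrudi λc i j = Ξe t ((ℤ.+ List.lookup λc i) ℤ.- (ℤ.+ toℕ i) ℤ.+ (ℤ.+ toℕ j))

      det-jacobiTrudi-hook : ∀ d →
        det (suc (List.length (List.replicate d 1))) (jacobiTrudi (suc r ∷ List.replicate d 1)) ≈ hookExpansion d
      det-jacobiTrudi-hook d = begin
        det (suc m) (jacobiTrudi (suc r ∷ List.replicate d 1))
          ≈⟨ det-cong (suc m) entry ⟩
        det (suc m) (hessenberg m a)
          ≈⟨ det-hessenberg m a ⟩
        sumBelow (suc m) (λ j → pow (- 1#) j * a j * Ĥ (m ∸ j))
          ≈⟨ sumBelow-cong (suc m) (λ j _ → trans (*-congʳ (sign-shift r j (t (suc (r ℕ.+ j))))) (*-assoc _ _ (Ĥ (m ∸ j)))) ⟩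
        sumBelow (suc m) (λ j → pow (- 1#) r * (t (suc (r ℕ.+ j)) * Ĥ (m ∸ j)))
          ≈⟨ *-distribˡ-sumBelow (suc m) (pow (- 1#) r) (λ j → t (suc (r ℕ.+ j)) * Ĥ (m ∸ j)) ⟨
        pow (- 1#) r * sumBelow (suc m) (λ j → t (suc (r ℕ.+ j)) * Ĥ (m ∸ j))
          ≡⟨ ≡.cong (λ m → pow (- 1#) r * sumBelow (suc m) (λ j → t (suc (r ℕ.+ j)) * Ĥ (m ∸ j))) (Listₚ.length-replicate d) ⟩
        hookExpansion d ∎
        where
        m : ℕ
        m = List.length (List.replicate d 1)
        a : ℕ → Carrier
        a j = Ξe t (ℤ.+ suc (r ℕ.+ j))
        subdiagonal-index : ∀ i k → ℤ.+ 1 ℤ.- ℤ.+ suc i ℤ.+ ℤ.+ k ≡ k ⊖ i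
        subdiagonal-index i k = ≡.trans (≡.cong (ℤ._+ ℤ.+ k) (≡.trans (ℤₚ.[1+m]⊖[1+n]≡m⊖n 0 i) (ℤₚ.⊖-≤ {n = i} z≤n)))
                                        (ℤₚ.-m+n≡n⊖m i k)
        entry : ∀ i k → jacobiTrudi (suc r ∷ List.replicate d 1) i k ≈ hessenberg m a i k
        entry zero k = reflexive (≡.cong (λ x → Ξe t (ℤ.+ suc (x ℕ.+ toℕ k))) (ℕₚ.+-identityʳ r))
        entry (suc i) k = reflexive (≡.cong (Ξe t) (≡.trans
          (≡.cong (λ x → ℤ.+ x ℤ.- ℤ.+ suc (toℕ i) ℤ.+ ℤ.+ toℕ k) (lookup-replicate d 1 i))
          (subdiagonal-index (toℕ i) (toℕ k))))

      schurReflect-hook : ∀ d → schurReflect (hook (suc (r ℕ.+ d)) r) t ≈ hookExpansion d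
      schurReflect-hook d =
        trans (reflexive (≡.cong (λ μ → det (List.length μ) (jacobiTrudi μ)) (conjugate-hook r d))) (det-jacobiTrudi-hook d)

      hook-isobaric : ∀ d → schurReflect (hook (suc (r ℕ.+ d)) r) t ≈ P (suc (r ℕ.+ d)) (ωhook r) t
      hook-isobaric d = begin
        schurReflect (hook n r) t ≈⟨ schurReflect-hook d ⟩
        hookExpansion d           ≈⟨ conv-ωhook-Ĥ d ⟨
        conv (ωt⁺ (ωhook r)) Ĥ n  ≈⟨ boxedP≈conv-Ĥ (ωhook r) {n} ℕₚ.≤-refl ⟨
        boxedP (ωhook r) n n      ≈⟨ P≈boxedP (ωhook r) n ⟨
        P n (ωhook r) t           ∎
        where
        n : ℕ
        n = suc (r ℕ.+ d)

-- The hypothesis 1 ≤ n is implied by r < n.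
theorem5 : ∀ {c ℓ : Level} (R : CommutativeRing c ℓ) (n r : ℕ) → 1 ≤ n → r < n →
    (t : ℕ → CommutativeRing.Carrier R) →
    CommutativeRing._≈_ R (Over.schurReflect R (hook n r) t) (Over.P R n (Over.ωhook R r) t)
theorem5 R n r _ r<n t with ℕₚ.m≤n⇒∃[o]m+o≡n r<n
... | d , ≡.refl = hook-isobaric R t r d
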